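{- For any two positive integers $l$ and $s$ with $l \geq 2$, there exists a hypergraph $\mathcal{F}$, all of whose hyperedges have size greater than $s$, such that $$\chi\left({\rm KG}^2(\mathcal{F}, s)\right) = l \quad \text{and} \quad {\rm ecd}^2(\mathcal{F}, s) = l + s.$$
   Context: A hypergraph $\mathcal{F}$ consists of a finite vertex set $V(\mathcal{F})$ and a set $E(\mathcal{F}) \subseteq 2^{V(\mathcal{F})} \setminus \{\varnothing\}$ of hyperedges. For an integer $r \geq 2$ and a nonnegative integer $s$ with $s < |e|$ for every hyperedge $e$ of $\mathcal{F}$, the generalized Kneser hypergraph ${\rm KG}^r(\mathcal{F}, s)$ is the $r$-uniform hypergraph with vertex set $E(\mathcal{F})$, in which $r$ hyperedges $e_1, \dots, e_r$ of $\mathcal{F}$ form a hyperedge iff $|e_i \cap e_j| \leq s$ for all distinct $i, j \in \{1, \dots, r\}$. Its chromatic number $\chi$ is the minimum cardinality of a set $C$ admitting a map $f: E(\mathcal{F}) \to C$ such that no hyperedge $\{e_1, \dots, e_r\}$ of ${\rm KG}^r(\mathcal{F}, s)$ is monochromatic, i.e. $|\{f(e_1), \dots, f(e_r)\}| \geq 2$. For sets $A, B$ and a nonnegative integer $s$, write $A \subseteq_s B$ if $|A \setminus B| \leq s$. The $s$-th equitable $r$-colorability defect ${\rm ecd}^r(\mathcal{F}, s)$ is the minimum size of a subset $X_0 \subseteq V(\mathcal{F})$ for which there is a partition $\{X_1, \dots, X_r\}$ of $V(\mathcal{F}) \setminus X_0$ (parts may be empty) such that $\bigl||X_i| - |X_j|\bigr|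 \leq 1$ for all $1 \leq i < j \leq r$, and $e \not\subseteq_s X_i$ for every hyperedge $e$ of $\mathcal{F}$ and every $i \in \{1, \dots, r\}$. -}

module Defs where

open import Data.Nat using (ℕ; _≤_; _<_; _+_)
open import Data.Nat.Properties using ()
open import Data.Fin using (Fin)
open import Data.Fin.Subset using (Subset; ∣_∣; _∩_; _∪_; _─_; ⊥; ⊤; Nonempty)
open import Data.Product using (Σ; _×_)
open import Relation.Binary.PropositionalEquality using (_≡_; _≢_)
open import Relation.Nullary using (¬_)
open import Function.Definitions using (Injective)

record Hypergraph : Set where
  field
    n        : ℕ
    m        : ℕ
    edge     : Fin m → Subset n
    edge-inj : Injective _≡_ _≡_ edge
    edge-ne  : (i : Fin m) → Nonempty (edge i)
open Hypergraph public

_⊆[_]_ : {n : ℕ} → Subset n → ℕ → Subset n → Set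
A ⊆[ s ] B = ∣ A ─ B ∣ ≤ s

KG2-Adj : (F : Hypergraph) → ℕ → Fin (m F) → Fin (m F) → Set
KG2-Adj F s i j = (i ≢ j) × (∣ edge F i ∩ edge F j ∣ ≤ s)

ProperColouring : Hypergraph → ℕ → ℕ → Set
ProperColouring F s k =
  Σ (Fin (m F) → Fin k) λ f →
    (i j : Fin (m F)) → KG2-Adj F s i j → f i ≢ f j

IsChromaticNumberKG2 : Hypergraph → ℕ → ℕ → Set
IsChromaticNumberKG2 F s k =
  ProperColouring F s k × ((j : ℕ) → j < k → ¬ ProperColouring F s j)

Within1 : ℕ → ℕ → Set
Within1 a b = (a ≤ b + 1) × (b ≤ a + 1)

record Admissible2 (F : Hypergraph) (s : ℕ) : Set where
  field
    X₀ X₁ X₂ : Subset (n F)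
    disj₀₁   : X₀ ∩ X₁ ≡ ⊥
    disj₀₂   : X₀ ∩ X₂ ≡ ⊥
    disj₁₂   : X₁ ∩ X₂ ≡ ⊥
    cover    : X₀ ∪ X₁ ∪ X₂ ≡ ⊤
    balanced : Within1 ∣ X₁ ∣ ∣ X₂ ∣
    avoid₁   : (i : Fin (m F)) → ¬ (edge F i ⊆[ s ] X₁)
    avoid₂   : (i : Fin (m F)) → ¬ (edge F i ⊆[ s ] X₂)
open Admissible2 public

IsEcd2 : Hypergraph → ℕ → ℕ → Set
IsEcd2 F s t =
  (Σ (Admissible2 F s) λ A → ∣ X₀ A ∣ ≡ t) ×
  ((A : Admissible2 F s) → t ≤ ∣ X₀ A ∣)

-- Take l hyperedges of size s + 1 forming a sunflower with an s-element kernel.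
-- Any two of them meet in exactly s vertices, so KG²(F, s) is the complete graph
-- on l vertices and needs l colours. On the other hand a hyperedge of size s + 1
-- is ⊆_s-contained in every set it meets, so an admissible X₁ or X₂ can contain
-- no vertex of any hyperedge; as the hyperedges cover all s + l vertices, X₀ is
-- the whole vertex set.
module Submission where

open import Defs
open import Data.Nat using (ℕ; zero; suc; _≤_; _<_; _+_; s≤s⁻¹)
open import Data.Nat.Properties using (+-comm; ≤-reflexive; ≤-trans; m≤m+n; 1+n≰n)
open import Data.Fin using (Fin; zero; suc; _↑ʳ_)
open import Data.Fin.Properties using (pigeonhole; <⇒≢)
open import Data.Fin.Subset
  using (Subset; ∣_∣; _∈_; _⊆_; ⁅_⁆; _∩_; ⊤; ⊥; inside; Nonempty; Empty)
open import Data.Fin.Subset.Properties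
open import Data.Vec.Base using (_∷_; _[_]=_)
open import Data.Empty using (⊥-elim)
open import Data.Product using (Σ; ∃; _×_; _,_)
open import Data.Sum using (inj₁; inj₂)
open import Relation.Binary.PropositionalEquality
  using (_≡_; _≢_; sym; trans; cong; subst)
open import Relation.Nullary using (¬_)
open import Function using (id)

open _[_]=_

complete⇒chromatic : (F : Hypergraph) (s : ℕ) →
  (∀ i j → i ≢ j → ∣ edge F i ∩ edge F j ∣ ≤ s) →
  IsChromaticNumberKG2 F s (m F)
complete⇒chromatic F s small = (id , λ i j (i≢j , _) → i≢j) , noFewer
  where
  noFewer : ∀ k → k < m F → ¬ ProperColouring F s k
  noFewer k k<m (f , proper) with pigeonhole k<m f
  ... | i , j , i<j , fi≡fj = proper i j (<⇒≢ i<j , small i j (<⇒≢ i<j)) fi≡fj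

meets⇒⊆[_] : ∀ {n} s (e X : Subset n) → ∣ e ∣ ≤ suc s → Nonempty (e ∩ X) → e ⊆[ s ] X
meets⇒⊆[ s ] e X ∣e∣≤1+s meet = s≤s⁻¹ (≤-trans (p∩q≢∅⇒∣p─q∣<∣p∣ e X meet) ∣e∣≤1+s)

module _ (F : Hypergraph) (s : ℕ) where

  trivialAdmissible : (∀ i → s < ∣ edge F i ∣) → Admissible2 F s
  trivialAdmissible large = record
    { X₀ = ⊤ ; X₁ = ⊥ ; X₂ = ⊥
    ; disj₀₁ = ∩-zeroʳ ⊤ ; disj₀₂ = ∩-zeroʳ ⊤ ; disj₁₂ = ∩-idem ⊥
    ; cover = ∪-zeroˡ _
    ; balanced = m≤m+n _ 1 , m≤m+n _ 1
    ; avoid₁ = notIn⊥ ; avoid₂ = notIn⊥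
    }
    where
    notIn⊥ : ∀ i → ¬ (edge F i ⊆[ s ] ⊥)
    notIn⊥ i ⊆⊥ = 1+n≰n (≤-trans (large i) (subst (λ e → ∣ e ∣ ≤ s) (p─⊥≡p (edge F i)) ⊆⊥))

  module _ (uniform : ∀ i → ∣ edge F i ∣ ≡ suc s)
           (covering : ∀ v → ∃ λ i → v ∈ edge F i) where

    avoided⇒empty : (X : Subset (n F)) → (∀ i → ¬ (edge F i ⊆[ s ] X)) → Empty X
    avoided⇒empty X avoid (v , v∈X) with covering v
    ... | i , v∈e = avoid i (meets⇒⊆[ s ] (edge F i) X (≤-reflexive (uniform i))
                                          (v , x∈p∩q⁺ (v∈e , v∈X)))

    admissible⇒X₀≡⊤ : (A : Admissible2 F s) → X₀ A ≡ ⊤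
    admissible⇒X₀≡⊤ A = ⊆-antisym ⊆⊤ ⊤⊆X₀
      where
      ⊤⊆X₀ : ⊤ ⊆ X₀ A
      ⊤⊆X₀ {v} _ with x∈p∪q⁻ (X₀ A) _ (subst (v ∈_) (sym (cover A)) ∈⊤)
      ... | inj₁ v∈X₀ = v∈X₀
      ... | inj₂ v∈X₁∪X₂ with x∈p∪q⁻ (X₁ A) (X₂ A) v∈X₁∪X₂
      ...   | inj₁ v∈X₁ = ⊥-elim (avoided⇒empty (X₁ A) (avoid₁ A) (v , v∈X₁))
      ...   | inj₂ v∈X₂ = ⊥-elim (avoided⇒empty (X₂ A) (avoid₂ A) (v , v∈X₂))

    uniform⇒ecd≡n : IsEcd2 F s (n F)
    uniform⇒ecd≡n =
      (trivialAdmissible (λ i → ≤-reflexive (sym (uniform i))) , ∣⊤∣≡n (n F)) ,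
      λ A → ≤-reflexive (trans (sym (∣⊤∣≡n (n F))) (cong ∣_∣ (sym (admissible⇒X₀≡⊤ A))))

-- The kernel is the first s vertices; the petal of the k-th hyperedge is s ↑ʳ k.
sunflower : ∀ {l} s → Fin l → Subset (s + l)
sunflower zero    k = ⁅ k ⁆
sunflower (suc s) k = inside ∷ sunflower s k

↑ʳ∈sunflower : ∀ {l} s (k : Fin l) → s ↑ʳ k ∈ sunflower s k
↑ʳ∈sunflower zero    k = x∈⁅x⁆ k
↑ʳ∈sunflower (suc s) k = there (↑ʳ∈sunflower s k)

↑ʳ∈sunflower⇒≡ : ∀ {l} s {j k : Fin l} → s ↑ʳ j ∈ sunflower s k → j ≡ k
↑ʳ∈sunflower⇒≡ zero    {k = k} j∈k = x∈⁅y⁆⇒x≡y k j∈k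
↑ʳ∈sunflower⇒≡ (suc s) (there j∈k) = ↑ʳ∈sunflower⇒≡ s j∈k

sunflower-injective : ∀ {l} s {j k : Fin l} → sunflower s j ≡ sunflower s k → j ≡ k
sunflower-injective s {j} eq = ↑ʳ∈sunflower⇒≡ s (subst (s ↑ʳ j ∈_) eq (↑ʳ∈sunflower s j))

∣sunflower∣≡1+s : ∀ {l} s (k : Fin l) → ∣ sunflower s k ∣ ≡ suc s
∣sunflower∣≡1+s zero    k = ∣⁅x⁆∣≡1 k
∣sunflower∣≡1+s (suc s) k = cong suc (∣sunflower∣≡1+s s k)

∣sunflower∩sunflower∣≡s : ∀ {l} s {j k : Fin l} → j ≢ k →
  ∣ sunflower s j ∩ sunflower s k ∣ ≡ s
∣sunflower∩sunflower∣≡s {l} zero {j} {k} j≢k =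
  trans (cong ∣_∣ (Empty-unique disjoint)) (∣⊥∣≡0 l)
  where
  disjoint : Empty (⁅ j ⁆ ∩ ⁅ k ⁆)
  disjoint (v , v∈j∩k) with x∈p∩q⁻ ⁅ j ⁆ ⁅ k ⁆ v∈j∩k
  ... | v∈j , v∈k = j≢k (trans (sym (x∈⁅y⁆⇒x≡y j v∈j)) (x∈⁅y⁆⇒x≡y k v∈k))
∣sunflower∩sunflower∣≡s (suc s) j≢k = cong suc (∣sunflower∩sunflower∣≡s s j≢k)

sunflower-covers : ∀ {l} s → Fin l → (v : Fin (s + l)) → ∃ λ k → v ∈ sunflower s k
sunflower-covers zero    _  v       = v , x∈⁅x⁆ v
sunflower-covers (suc s) k₀ zero    = k₀ , here
sunflower-covers (suc s) k₀ (suc v) with sunflower-covers s k₀ v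
... | k , v∈k = k , there v∈k

Sunflower : ℕ → ℕ → Hypergraph
Sunflower s l = record
  { n = s + l ; m = l ; edge = sunflower s
  ; edge-inj = sunflower-injective s
  ; edge-ne = λ k → s ↑ʳ k , ↑ʳ∈sunflower s k
  }

theorem2 : (l s : ℕ) → 2 ≤ l → 1 ≤ s →
    Σ Hypergraph λ F →
      ((i : Fin (m F)) → s < ∣ edge F i ∣) ×
      IsChromaticNumberKG2 F s l ×
      IsEcd2 F s (l + s)
theorem2 l@(suc _) s _ _ =
  Sunflower s l ,
  (λ k → ≤-reflexive (sym (∣sunflower∣≡1+s s k))) ,
  complete⇒chromatic (Sunflower s l) s
    (λ j k j≢k → ≤-reflexive (∣sunflower∩sunflower∣≡s s j≢k)) ,
  subst (IsEcd2 (Sunflower s l) s) (+-comm s l)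
    (uniform⇒ecd≡n (Sunflower s l) s (∣sunflower∣≡1+s s) (sunflower-covers s zero))
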